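{- For every $n\geq0$, the polynomial $\sum_{k=0}^n (1-q)^{n-k}S_1[n,k]\,x^k$ equals the weighted generating function of Schröder paths of length $2n$ in which each step $(1,1)$ has weight $1$, each step $(1,-1)$ starting at height $i$ has weight $1-q^i$, and each step $(2,0)$ at height $i$ has weight either $x-1$ or $q^{i+1}$ (i.e. each such step comes in two colored versions with these weights, equivalently it has total weight $x-1+q^{i+1}$).
   Context: A Schröder path of length $2n$ is a lattice path in $\mathbb{N}^2$ from $(0,0)$ to $(2n,0)$ with steps $(1,1)$, $(1,-1)$ or $(2,0)$; the height of a point is its $y$-coordinate. The weight of a path is the product of the weights of its steps, and the generating function is the sum of weights of all (colored) paths. For $n\geq 0$ let $\mathfrak{S}_n$ be the set of permutations of $\{1,\dots,n\}$. For $\sigma\in\mathfrak{S}_n$, a right-to-left maximum is an index $i$ such that $\sigma(i)>\sigma(j)$ for all $j$ with $i<j\leq n$; let $\mathrm{rlm}(\sigma)$ be their number. An inversion of $\sigma$ is a pair $(i,j)$ with $i<j$ and $\sigma(i)>\sigma(j)$; it is special if there exists $k'$ with $j<k'\leq n$ and $\sigma(i)<\sigma(k')$. Let $\mathrm{inv}'(\sigma)$ be the number of special inversions. Define $S_1[n,k]=\sum_{\sigma} q^{\mathrm{inv}'(\sigma)}$, summed over $\sigma\in\mathfrak{S}_n$ with $\mathrm{rlm}(\sigma)=k$. -}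

module Defs where

open import Level using (Level)
open import Data.Nat using (ℕ; zero; suc; _<ᵇ_; _∸_; _≡ᵇ_)
open import Data.Bool using (Bool; true; false; if_then_else_; _∧_)
open import Data.List using (List; []; _∷_; map; concatMap; _++_; filter; foldr; upTo)
open import Data.Bool.ListAction using (all; any)
open import Algebra.Bundles using (CommutativeRing)

-- Permutations of {1,…,n}, in one-line notation [σ(1), …, σ(n)]

insertions : ℕ → List ℕ → List (List ℕ)
insertions a []       = (a ∷ []) ∷ []
insertions a (b ∷ xs) = (a ∷ b ∷ xs) ∷ map (b ∷_) (insertions a xs)

perms : ℕ → List (List ℕ)
perms zero    = [] ∷ []
perms (suc n) = concatMap (insertions (suc n)) (perms n)

rlm : List ℕ → ℕ
rlm []       = 0
rlm (a ∷ xs) = (if all (_<ᵇ a) xs then 1 else 0) Data.Nat.+ rlm xs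

specialFrom : ℕ → List ℕ → ℕ
specialFrom a []       = 0
specialFrom a (b ∷ ys) =
  (if (b <ᵇ a) ∧ any (a <ᵇ_) ys then 1 else 0) Data.Nat.+ specialFrom a ys

inv′ : List ℕ → ℕ
inv′ []       = 0
inv′ (a ∷ xs) = specialFrom a xs Data.Nat.+ inv′ xs

-- Schröder paths: words in the steps U = (1,1), D = (1,-1),
-- and the two coloured versions L₁, L₂ of the level step (2,0)

data Step : Set where
  U D L₁ L₂ : Step

words : ℕ → List (List Step)
words zero          = [] ∷ []
words (suc zero)    = (U ∷ []) ∷ (D ∷ []) ∷ []
words (suc (suc m)) =
  map (U ∷_) (words (suc m)) ++ map (D ∷_) (words (suc m))
  ++ map (L₁ ∷_) (words m) ++ map (L₂ ∷_) (words m)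

isPath : ℕ → List Step → Bool
isPath h       []       = h ≡ᵇ 0
isPath h       (U ∷ w)  = isPath (suc h) w
isPath zero    (D ∷ w)  = false
isPath (suc h) (D ∷ w)  = isPath h w
isPath h       (L₁ ∷ w) = isPath h w
isPath h       (L₂ ∷ w) = isPath h w

schroderPaths : ℕ → List (List Step)
schroderPaths n = filter (λ w → Data.Bool._≟_ (isPath 0 w) true) (words (2 Data.Nat.* n))

-- Polynomial identities are stated uniformly over every commutative ring
-- (q and x arbitrary elements), i.e. as identities in ℤ[q,x].

module _ {c ℓ : Level} (R : CommutativeRing c ℓ) where
  open CommutativeRing R

  pow : Carrier → ℕ → Carrier
  pow a zero    = 1#
  pow a (suc k) = a * pow a k

  sumR : List Carrier → Carrier
  sumR = foldr _+_ 0#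

  S₁ : Carrier → ℕ → ℕ → Carrier
  S₁ q n k = sumR (map (λ σ → pow q (inv′ σ))
                       (filter (λ σ → Data.Nat._≟_ (rlm σ) k) (perms n)))

  lhs : Carrier → Carrier → ℕ → Carrier
  lhs q x n = sumR (map (λ k → pow (1# - q) (n ∸ k) * S₁ q n k * pow x k)
                        (upTo (suc n)))

  weight : Carrier → Carrier → ℕ → List Step → Carrier
  weight q x h []       = 1#
  weight q x h (U ∷ w)  = 1# * weight q x (suc h) w
  weight q x h (D ∷ w)  = (1# - pow q h) * weight q x (h ∸ 1) w
  weight q x h (L₁ ∷ w) = (x - 1#) * weight q x h w
  weight q x h (L₂ ∷ w) = pow q (suc h) * weight q x h w

  schroderGF : Carrier → Carrier → ℕ → Carrier
  schroderGF q x n = sumR (map (weight q x 0) (schroderPaths n))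

-- Both sides are read off one recursion, run in two directions.
--
-- Give a permutation the weight x for each right-to-left maximum and (1 - q) q^s
-- for every other entry opening s special inversions; summed over 𝔖ₙ this is
-- the left-hand side. Let permGF k n weight each σ ∈ 𝔖ₙ in addition by
-- h_k(q^{g_n}, …, q^{g_1}), where g_b counts the special inversions created by
-- putting a new value b in front of σ. Splitting 𝔖ₙ₊₁ by the first entry and
-- telescoping an exchange identity for h_k yields
--   permGF k (n+1) = x Σ_{j ≤ k} permGF j n + (1 - q^{k+1}) permGF (k+1) n.
--
-- On the path side let suffixGF a k be the generating function of the parts
-- after k initial up steps of Schröder paths of length 2a; the first step of
-- that part gives
--   suffixGF (a+1) k - suffixGF (a+1) (k+1) = (x - 1 + q^{k+1}) suffixGF a k + (1 - q^k) suffixGF a (k-1).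
-- The two recursions are adjoint, so Σ_k suffixGF a k · permGF k b depends only
-- on a + b. At b = 0 it is the Schröder generating function suffixGF n 0 and at
-- a = 0 it is permGF 0 n, the left-hand side.

module Submission where

open import Defs
open import Function using (id; _∘_)
open import Data.Nat as ℕ using (ℕ; zero; suc; pred; _∸_; _<ᵇ_; _≤_; _<_; z≤n; s≤s)
import Data.Nat.Properties as ℕP
import Data.Bool as Bool
open import Data.Bool using (Bool; true; false; if_then_else_; _∧_; _∨_; T)
open import Data.Bool.ListAction using (all; any)
open import Data.List using (List; []; _∷_; [_]; _++_; map; concatMap; filter; length; upTo; applyUpTo)
open import Data.List.Properties using (map-++; ++-assoc; map-∘; map-cong; map-cong-local)
open import Data.List.Relation.Unary.All as All using (All; []; _∷_)
import Data.List.Relation.Unary.All.Properties as Allₚ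
open import Data.List.Relation.Unary.Any as Any using (Any; here; there)
import Data.List.Relation.Unary.Any.Properties as Anyₚ
open import Data.Sum using (inj₁; inj₂)
open import Data.Empty using (⊥-elim)
open import Data.Product using (_,_)
open import Relation.Nullary using (does)
open import Relation.Unary using (Decidable)
open import Algebra.Bundles using (CommutativeRing)
open import Relation.Binary.PropositionalEquality using (_≡_; _≢_; refl; sym; trans; cong; cong₂; subst; module ≡-Reasoning)

<⇒<ᵇ≡true : ∀ {m n} → m < n → (m <ᵇ n) ≡ true
<⇒<ᵇ≡true {zero}  (s≤s _)   = refl
<⇒<ᵇ≡true {suc m} (s≤s m<n) = <⇒<ᵇ≡true m<n

≥⇒<ᵇ≡false : ∀ {m n} → n ≤ m → (m <ᵇ n) ≡ false
≥⇒<ᵇ≡false {m}     {zero}  _         = refl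
≥⇒<ᵇ≡false {suc m} {suc n} (s≤s n≤m) = ≥⇒<ᵇ≡false n≤m

all-<ᵇ≡true : ∀ {a xs} → All (_< a) xs → all (_<ᵇ a) xs ≡ true
all-<ᵇ≡true []                 = refl
all-<ᵇ≡true (x<a ∷ xs<a) rewrite <⇒<ᵇ≡true x<a = all-<ᵇ≡true xs<a

all-<ᵇ≡true⇒All : ∀ {a} xs → all (_<ᵇ a) xs ≡ true → All (_< a) xs
all-<ᵇ≡true⇒All         []       _  = []
all-<ᵇ≡true⇒All {a} (y ∷ ys) eq with y <ᵇ a in y<ᵇa
... | true = ℕP.<ᵇ⇒< y a (subst T (sym y<ᵇa) _) ∷ all-<ᵇ≡true⇒All ys eq

all-<ᵇ≡false : ∀ {a xs} → Any (λ y → a ≤ y) xs → all (_<ᵇ a) xs ≡ false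
all-<ᵇ≡false {a} {y ∷ ys} (here a≤y) rewrite ≥⇒<ᵇ≡false a≤y = refl
all-<ᵇ≡false {a} {y ∷ ys} (there p)  rewrite all-<ᵇ≡false {a} {ys} p with y <ᵇ a
... | true  = refl
... | false = refl

any-<ᵇ≡true : ∀ {a xs} → Any (a <_) xs → any (a <ᵇ_) xs ≡ true
any-<ᵇ≡true {a} {y ∷ ys} (here a<y) rewrite <⇒<ᵇ≡true a<y = refl
any-<ᵇ≡true {a} {y ∷ ys} (there p)  rewrite any-<ᵇ≡true {a} {ys} p with a <ᵇ y
... | true  = refl
... | false = refl

any-<ᵇ≡false : ∀ {a xs} → All (_< a) xs → any (a <ᵇ_) xs ≡ false
any-<ᵇ≡false []                 = refl
any-<ᵇ≡false (x<a ∷ xs<a) rewrite ≥⇒<ᵇ≡false (ℕP.<⇒≤ x<a) = any-<ᵇ≡false xs<a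

specialFrom-max : ∀ {a xs} → All (_< a) xs → specialFrom a xs ≡ 0
specialFrom-max {a} {y ∷ ys} (y<a ∷ ys<a)
  rewrite any-<ᵇ≡false ys<a | <⇒<ᵇ≡true y<a = specialFrom-max ys<a
specialFrom-max [] = refl

downFrom₁ : ℕ → List ℕ
downFrom₁ zero    = []
downFrom₁ (suc n) = suc n ∷ downFrom₁ n

above : ℕ → ℕ → List ℕ
above zero    a = []
above (suc j) a = suc (j ℕ.+ a) ∷ above j a

downFrom₁-++ : ∀ j a → downFrom₁ (j ℕ.+ a) ≡ above j a ++ downFrom₁ a
downFrom₁-++ zero    a = refl
downFrom₁-++ (suc j) a = cong (suc (j ℕ.+ a) ∷_) (downFrom₁-++ j a)

above-> : ∀ j a → All (a <_) (above j a)
above-> zero    a = []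
above-> (suc j) a = s≤s (ℕP.m≤n+m a j) ∷ above-> j a

above-suc : ∀ j a → above (suc j) a ≡ above j (suc a) ++ [ suc a ]
above-suc zero    a = refl
above-suc (suc j) a = cong₂ _∷_ (cong suc (sym (ℕP.+-suc j a))) (above-suc j a)

map-pred-above : ∀ {ℓ} {X : Set ℓ} (f : ℕ → X) j a → map (f ∘ pred) (above (suc j) a) ≡ map f (above j a) ++ [ f a ]
map-pred-above f zero    a = refl
map-pred-above f (suc j) a = cong (f (suc (j ℕ.+ a)) ∷_) (map-pred-above f j a)

downFrom₁-≤ : ∀ a → All (_≤ a) (downFrom₁ a)
downFrom₁-≤ zero    = []
downFrom₁-≤ (suc a) = ℕP.≤-refl ∷ All.map ℕP.m≤n⇒m≤1+n (downFrom₁-≤ a)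

downFrom₁-≥1 : ∀ a → All (1 ≤_) (downFrom₁ a)
downFrom₁-≥1 zero    = []
downFrom₁-≥1 (suc a) = s≤s z≤n ∷ downFrom₁-≥1 a

map-threshold : ∀ {ℓ} {X : Set ℓ} (f g : ℕ → X) j a →
  map (λ b → if a <ᵇ b then f b else g b) (downFrom₁ (j ℕ.+ a)) ≡ map f (above j a) ++ map g (downFrom₁ a)
map-threshold f g j a rewrite downFrom₁-++ j a | map-++ (λ b → if a <ᵇ b then f b else g b) (above j a) (downFrom₁ a) =
  cong₂ _++_ (map-cong-local (All.map (λ {b} a<b → cong (λ t → if t then f b else g b) (<⇒<ᵇ≡true a<b)) (above-> j a)))
             (map-cong-local (All.map (λ {b} b≤a → cong (λ t → if t then f b else g b) (≥⇒<ᵇ≡false b≤a)) (downFrom₁-≤ a)))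

map-threshold-pred : ∀ {ℓ} {X : Set ℓ} (f g : ℕ → X) j a →
  map (λ b → if a <ᵇ b then f b else g b) (downFrom₁ (j ℕ.+ suc a)) ≡ map f (above j (suc a)) ++ f (suc a) ∷ map g (downFrom₁ a)
map-threshold-pred f g j a = begin
  map (λ b → if a <ᵇ b then f b else g b) (downFrom₁ (j ℕ.+ suc a))
    ≡⟨ cong (map (λ b → if a <ᵇ b then f b else g b) ∘ downFrom₁) (ℕP.+-suc j a) ⟩
  map (λ b → if a <ᵇ b then f b else g b) (downFrom₁ (suc j ℕ.+ a))
    ≡⟨ map-threshold f g (suc j) a ⟩
  map f (above (suc j) a) ++ map g (downFrom₁ a)
    ≡⟨ cong (λ l → map f l ++ map g (downFrom₁ a)) (above-suc j a) ⟩
  map f (above j (suc a) ++ [ suc a ]) ++ map g (downFrom₁ a)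
    ≡⟨ cong (_++ map g (downFrom₁ a)) (map-++ f (above j (suc a)) [ suc a ]) ⟩
  (map f (above j (suc a)) ++ [ f (suc a) ]) ++ map g (downFrom₁ a)
    ≡⟨ ++-assoc (map f (above j (suc a))) [ f (suc a) ] (map g (downFrom₁ a)) ⟩
  map f (above j (suc a)) ++ f (suc a) ∷ map g (downFrom₁ a) ∎
  where open ≡-Reasoning

map-threshold-double : ∀ {ℓ} {X : Set ℓ} (f g : ℕ → X) j a →
  map (λ b → if suc a <ᵇ b then f (pred b) else g b) (downFrom₁ (suc j ℕ.+ suc a))
    ≡ map f (above j (suc a)) ++ f (suc a) ∷ g (suc a) ∷ map g (downFrom₁ a)
map-threshold-double f g j a = trans (map-threshold (f ∘ pred) g (suc j) (suc a))
  (trans (cong (_++ map g (downFrom₁ (suc a))) (map-pred-above f j (suc a)))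
         (++-assoc (map f (above j (suc a))) [ f (suc a) ] (map g (downFrom₁ (suc a)))))

bump : ℕ → ℕ → ℕ
bump a x = if x <ᵇ a then x else suc x

bump-< : ∀ {a x} → x < a → bump a x ≡ x
bump-< x<a rewrite <⇒<ᵇ≡true x<a = refl

bump-≥ : ∀ {a x} → a ≤ x → bump a x ≡ suc x
bump-≥ a≤x rewrite ≥⇒<ᵇ≡false a≤x = refl

bump-<ᵇ : ∀ a x y → (bump a x <ᵇ bump a y) ≡ (x <ᵇ y)
bump-<ᵇ a x y with ℕP.≤-<-connex a x | ℕP.≤-<-connex a y
... | inj₂ x<a | inj₂ y<a rewrite bump-< x<a | bump-< y<a = refl
... | inj₁ a≤x | inj₁ a≤y rewrite bump-≥ a≤x | bump-≥ a≤y = refl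
... | inj₂ x<a | inj₁ a≤y
  rewrite bump-< x<a | bump-≥ a≤y
        | <⇒<ᵇ≡true (ℕP.<-trans x<a (s≤s a≤y)) | <⇒<ᵇ≡true (ℕP.<-≤-trans x<a a≤y) = refl
... | inj₁ a≤x | inj₂ y<a
  rewrite bump-≥ a≤x | bump-< y<a
        | ≥⇒<ᵇ≡false (ℕP.m≤n⇒m≤1+n (ℕP.<⇒≤ (ℕP.<-≤-trans y<a a≤x)))
        | ≥⇒<ᵇ≡false (ℕP.<⇒≤ (ℕP.<-≤-trans y<a a≤x)) = refl

bump-bump : ∀ {a b} → b ≤ a → ∀ x → bump b (bump a x) ≡ bump (suc a) (bump b x)
bump-bump {a} {b} b≤a x with ℕP.≤-<-connex a x
... | inj₁ a≤x
  rewrite bump-≥ a≤x | bump-≥ (ℕP.≤-trans b≤a a≤x)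
        | bump-≥ {b} (ℕP.m≤n⇒m≤1+n (ℕP.≤-trans b≤a a≤x)) | bump-≥ (s≤s a≤x) = refl
... | inj₂ x<a with ℕP.≤-<-connex b x
...   | inj₁ b≤x rewrite bump-< x<a | bump-≥ b≤x | bump-< (s≤s x<a) = refl
...   | inj₂ x<b rewrite bump-< x<a | bump-< x<b | bump-< (ℕP.m≤n⇒m≤1+n x<a) = refl

module OrderEmbedding (g : ℕ → ℕ) (g-<ᵇ : ∀ x y → (g x <ᵇ g y) ≡ (x <ᵇ y)) where

  all-map : ∀ a xs → all (_<ᵇ g a) (map g xs) ≡ all (_<ᵇ a) xs
  all-map a []       = refl
  all-map a (y ∷ ys) = cong₂ _∧_ (g-<ᵇ y a) (all-map a ys)

  any-map : ∀ a xs → any (g a <ᵇ_) (map g xs) ≡ any (a <ᵇ_) xs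
  any-map a []       = refl
  any-map a (y ∷ ys) = cong₂ _∨_ (g-<ᵇ a y) (any-map a ys)

  specialFrom-map : ∀ a xs → specialFrom (g a) (map g xs) ≡ specialFrom a xs
  specialFrom-map a []       = refl
  specialFrom-map a (y ∷ ys) =
    cong₂ ℕ._+_ (cong (λ t → if t then 1 else 0) (cong₂ _∧_ (g-<ᵇ y a) (any-map a ys)))
                (specialFrom-map a ys)

specialFrom-bump : ∀ a b xs → specialFrom (bump a b) (map (bump a) xs) ≡ specialFrom b xs
specialFrom-bump a = OrderEmbedding.specialFrom-map (bump a) (bump-<ᵇ a)

-- The special inversions starting at the front of b ∷ σ′, where σ′ is σ with
-- its entries ≥ b raised by one.
specialAtFront : List ℕ → ℕ → ℕ
specialAtFront σ b = specialFrom b (map (bump b) σ)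

map-bump-bump : ∀ {a b} → b ≤ a → ∀ xs → map (bump b) (map (bump a) xs) ≡ map (bump (suc a)) (map (bump b) xs)
map-bump-bump b≤a xs = trans (sym (map-∘ xs)) (trans (map-cong (bump-bump b≤a) xs) (map-∘ xs))

specialFrom-∷-≥ : ∀ {a y} ys → a ≤ y → specialFrom a (y ∷ ys) ≡ specialFrom a ys
specialFrom-∷-≥ ys a≤y rewrite ≥⇒<ᵇ≡false a≤y = refl

specialFrom-∷-< : ∀ {a y ys} → y < a → Any (a <_) ys → specialFrom a (y ∷ ys) ≡ suc (specialFrom a ys)
specialFrom-∷-< y<a a<ys rewrite <⇒<ᵇ≡true y<a | any-<ᵇ≡true a<ys = refl

specialAtFront-∷-≤ : ∀ {a b} τ → b ≤ a → specialAtFront (a ∷ map (bump a) τ) b ≡ specialAtFront τ b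
specialAtFront-∷-≤ {a} {b} τ b≤a = begin
  specialFrom b (bump b a ∷ map (bump b) (map (bump a) τ))
    ≡⟨ cong (λ y → specialFrom b (y ∷ map (bump b) (map (bump a) τ))) (bump-≥ b≤a) ⟩
  specialFrom b (suc a ∷ map (bump b) (map (bump a) τ))
    ≡⟨ specialFrom-∷-≥ (map (bump b) (map (bump a) τ)) (ℕP.m≤n⇒m≤1+n b≤a) ⟩
  specialFrom b (map (bump b) (map (bump a) τ))
    ≡⟨ cong (specialFrom b) (map-bump-bump b≤a τ) ⟩
  specialFrom b (map (bump (suc a)) (map (bump b) τ))
    ≡⟨ cong (λ y → specialFrom y (map (bump (suc a)) (map (bump b) τ))) (sym (bump-< (s≤s b≤a))) ⟩
  specialFrom (bump (suc a) b) (map (bump (suc a)) (map (bump b) τ))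
    ≡⟨ specialFrom-bump (suc a) b (map (bump b) τ) ⟩
  specialFrom b (map (bump b) τ) ∎
  where open ≡-Reasoning

bump-bump-∋ : ∀ {a b n} τ → a ≤ b → b ≤ n → Any (_≡ n) τ → Any (suc b <_) (map (bump (suc b)) (map (bump a) τ))
bump-bump-∋ {a} {b} τ a≤b b≤n = Anyₚ.map⁺ ∘ Anyₚ.map⁺ ∘ Any.map λ { refl →
  subst (suc b <_) (sym (trans (cong (bump (suc b)) (bump-≥ (ℕP.≤-trans a≤b b≤n))) (bump-≥ (s≤s b≤n))))
        (s≤s (s≤s b≤n)) }

specialAtFront-∷-> : ∀ {a b n} τ → a ≤ b → b ≤ n → Any (_≡ n) τ →
  specialAtFront (a ∷ map (bump a) τ) (suc b) ≡ suc (specialAtFront τ b)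
specialAtFront-∷-> {a} {b} τ a≤b b≤n n∈τ = begin
  specialFrom (suc b) (bump (suc b) a ∷ map (bump (suc b)) (map (bump a) τ))
    ≡⟨ cong (λ y → specialFrom (suc b) (y ∷ map (bump (suc b)) (map (bump a) τ))) (bump-< (s≤s a≤b)) ⟩
  specialFrom (suc b) (a ∷ map (bump (suc b)) (map (bump a) τ))
    ≡⟨ specialFrom-∷-< (s≤s a≤b) (bump-bump-∋ τ a≤b b≤n n∈τ) ⟩
  suc (specialFrom (suc b) (map (bump (suc b)) (map (bump a) τ)))
    ≡⟨ cong (λ xs → suc (specialFrom (suc b) xs)) (sym (map-bump-bump a≤b τ)) ⟩
  suc (specialFrom (suc b) (map (bump a) (map (bump b) τ)))
    ≡⟨ cong (λ y → suc (specialFrom y (map (bump a) (map (bump b) τ)))) (sym (bump-≥ a≤b)) ⟩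
  suc (specialFrom (bump a b) (map (bump a) (map (bump b) τ)))
    ≡⟨ cong suc (specialFrom-bump a b (map (bump b) τ)) ⟩
  suc (specialFrom b (map (bump b) τ)) ∎
  where open ≡-Reasoning

insertions-bump : ∀ a b ρ → map (map (bump a)) (insertions b ρ) ≡ insertions (bump a b) (map (bump a) ρ)
insertions-bump a b []      = refl
insertions-bump a b (c ∷ ρ) = cong ((bump a b ∷ bump a c ∷ map (bump a) ρ) ∷_) (begin
  map (map (bump a)) (map (c ∷_) (insertions b ρ))       ≡⟨ sym (map-∘ (insertions b ρ)) ⟩
  map (λ u → bump a c ∷ map (bump a) u) (insertions b ρ)  ≡⟨ map-∘ (insertions b ρ) ⟩
  map (bump a c ∷_) (map (map (bump a)) (insertions b ρ)) ≡⟨ cong (map (bump a c ∷_)) (insertions-bump a b ρ) ⟩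
  map (bump a c ∷_) (insertions (bump a b) (map (bump a) ρ)) ∎)
  where open ≡-Reasoning

insertions-All : ∀ {P : ℕ → Set} {b} σ → P b → All P σ → All (All P) (insertions b σ)
insertions-All []      pb []         = (pb ∷ []) ∷ []
insertions-All (c ∷ σ) pb (pc ∷ pσ) =
  (pb ∷ pc ∷ pσ) ∷ Allₚ.map⁺ (All.map (pc ∷_) (insertions-All σ pb pσ))

insertions-length : ∀ b σ → All (λ u → length u ≡ suc (length σ)) (insertions b σ)
insertions-length b []      = refl ∷ []
insertions-length b (c ∷ σ) = refl ∷ Allₚ.map⁺ (All.map (cong suc) (insertions-length b σ))

insertions-∋ : ∀ b σ → All (Any (_≡ b)) (insertions b σ)
insertions-∋ b []      = here refl ∷ []
insertions-∋ b (c ∷ σ) = here refl ∷ Allₚ.map⁺ (All.map there (insertions-∋ b σ))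

All-perms-suc : ∀ {P : List ℕ → Set} n → All (λ σ → All P (insertions (suc n) σ)) (perms n) → All P (perms (suc n))
All-perms-suc n = Allₚ.concat⁺ ∘ Allₚ.map⁺

perms-< : ∀ n → All (All (_< suc n)) (perms n)
perms-< zero    = [] ∷ []
perms-< (suc n) = All-perms-suc n (All.map (λ {σ} σ<n → insertions-All σ ℕP.≤-refl (All.map ℕP.m≤n⇒m≤1+n σ<n)) (perms-< n))

perms-length : ∀ n → All (λ σ → length σ ≡ n) (perms n)
perms-length zero    = refl ∷ []
perms-length (suc n) = All-perms-suc n
  (All.map (λ {σ} eq → All.map (λ eq′ → trans eq′ (cong suc eq)) (insertions-length (suc n) σ)) (perms-length n))

perms-∋max : ∀ n → All (λ τ → 1 ≤ n → Any (_≡ n) τ) (perms n)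
perms-∋max zero    = (λ ()) ∷ []
perms-∋max (suc n) = All-perms-suc n (All.tabulate (λ {σ} _ → All.map (λ n∈ _ → n∈) (insertions-∋ (suc n) σ)))

rlm≤length : ∀ xs → rlm xs ≤ length xs
rlm≤length []       = z≤n
rlm≤length (a ∷ xs) with all (_<ᵇ a) xs
... | true  = s≤s (rlm≤length xs)
... | false = ℕP.m≤n⇒m≤1+n (rlm≤length xs)

module _ {c ℓ} (R : CommutativeRing c ℓ) where
  open CommutativeRing R hiding (zero) renaming (refl to ≈-refl; sym to ≈-sym; trans to ≈-trans)
  open import Relation.Binary.Reasoning.Setoid setoid
  open import Algebra.Solver.Ring.NaturalCoefficients.Default commutativeSemiring using (solve; _:=_; _:+_; _:*_)
  open import Algebra.Properties.Ring ring using (-‿distribˡ-*; -‿involutive)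

  infixr 8 _^_
  _^_ : Carrier → ℕ → Carrier
  a ^ k = pow R a k

  ∑ : {A : Set} → List A → (A → Carrier) → Carrier
  ∑ xs f = sumR R (map f xs)
  syntax ∑ xs (λ x → e) = ∑[ x ∈ xs ] e

  ∑-cong-All : {A : Set} {xs : List A} {f g : A → Carrier} → All (λ x → f x ≈ g x) xs → ∑ xs f ≈ ∑ xs g
  ∑-cong-All []       = ≈-refl
  ∑-cong-All (e ∷ es) = +-cong e (∑-cong-All es)

  ∑-cong : {A : Set} (xs : List A) {f g : A → Carrier} → (∀ x → f x ≈ g x) → ∑ xs f ≈ ∑ xs g
  ∑-cong xs f≈g = ∑-cong-All {xs = xs} (All.tabulate (λ {x} _ → f≈g x))

  ∑-++ : {A : Set} (xs ys : List A) (f : A → Carrier) → ∑ (xs ++ ys) f ≈ ∑ xs f + ∑ ys f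
  ∑-++ []       ys f = ≈-sym (+-identityˡ _)
  ∑-++ (x ∷ xs) ys f = ≈-trans (+-congˡ (∑-++ xs ys f)) (≈-sym (+-assoc _ _ _))

  ∑-+ : {A : Set} (xs : List A) (f g : A → Carrier) → ∑[ x ∈ xs ] (f x + g x) ≈ ∑ xs f + ∑ xs g
  ∑-+ []       f g = ≈-sym (+-identityˡ 0#)
  ∑-+ (x ∷ xs) f g = ≈-trans (+-congˡ (∑-+ xs f g))
    (solve 4 (λ a b c d → (a :+ b) :+ (c :+ d) := (a :+ c) :+ (b :+ d)) ≈-refl (f x) (g x) (∑ xs f) (∑ xs g))

  ∑-*ˡ : {A : Set} (xs : List A) (k : Carrier) (f : A → Carrier) → ∑[ x ∈ xs ] (k * f x) ≈ k * ∑ xs f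
  ∑-*ˡ []       k f = ≈-sym (zeroʳ k)
  ∑-*ˡ (x ∷ xs) k f = ≈-trans (+-congˡ (∑-*ˡ xs k f)) (≈-sym (distribˡ k (f x) (∑ xs f)))

  ∑-*ʳ : {A : Set} (xs : List A) (k : Carrier) (f : A → Carrier) → ∑[ x ∈ xs ] (f x * k) ≈ ∑ xs f * k
  ∑-*ʳ xs k f = ≈-trans (∑-cong xs (λ x → *-comm (f x) k)) (≈-trans (∑-*ˡ xs k f) (*-comm k _))

  ∑-0 : {A : Set} (xs : List A) → ∑[ x ∈ xs ] 0# ≈ 0#
  ∑-0 []       = ≈-refl
  ∑-0 (x ∷ xs) = ≈-trans (+-congˡ (∑-0 xs)) (+-identityʳ 0#)

  ∑-map : {A B : Set} (h : A → B) (xs : List A) (f : B → Carrier) → ∑ (map h xs) f ≈ ∑[ x ∈ xs ] f (h x)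
  ∑-map h []       f = ≈-refl
  ∑-map h (x ∷ xs) f = +-congˡ (∑-map h xs f)

  ∑-concatMap : {A B : Set} (h : A → List B) (xs : List A) (f : B → Carrier) →
    ∑ (concatMap h xs) f ≈ ∑[ x ∈ xs ] ∑ (h x) f
  ∑-concatMap h []       f = ≈-refl
  ∑-concatMap h (x ∷ xs) f = ≈-trans (∑-++ (h x) (concatMap h xs) f) (+-congˡ (∑-concatMap h xs f))

  ∑-comm : {A B : Set} (xs : List A) (ys : List B) (h : A → B → Carrier) →
    ∑[ x ∈ xs ] ∑[ y ∈ ys ] h x y ≈ ∑[ y ∈ ys ] ∑[ x ∈ xs ] h x y
  ∑-comm []       ys h = ≈-sym (∑-0 ys)
  ∑-comm (x ∷ xs) ys h =
    ≈-trans (+-congˡ (∑-comm xs ys h)) (≈-sym (∑-+ ys (h x) (λ y → ∑[ x ∈ xs ] h x y)))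

  ∑-filter : {A : Set} {P : A → Set} (P? : Decidable P) (xs : List A) (f : A → Carrier) →
    ∑ (filter P? xs) f ≈ ∑[ x ∈ xs ] (if does (P? x) then f x else 0#)
  ∑-filter P? []       f = ≈-refl
  ∑-filter P? (y ∷ ys) f with does (P? y)
  ... | true  = +-congˡ (∑-filter P? ys f)
  ... | false = ≈-trans (∑-filter P? ys f) (≈-sym (+-identityˡ _))

  ∑< : ℕ → (ℕ → Carrier) → Carrier
  ∑< zero    f = 0#
  ∑< (suc n) f = ∑< n f + f n
  syntax ∑< n (λ i → e) = ∑[ i < n ] e

  ∑<-cong : ∀ n {f g : ℕ → Carrier} → (∀ i → i < n → f i ≈ g i) → ∑< n f ≈ ∑< n g
  ∑<-cong zero    f≈g = ≈-refl
  ∑<-cong (suc n) f≈g = +-cong (∑<-cong n (λ i i<n → f≈g i (ℕP.m≤n⇒m≤1+n i<n))) (f≈g n ℕP.≤-refl)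

  ∑<-0 : ∀ n → ∑[ i < n ] 0# ≈ 0#
  ∑<-0 zero    = ≈-refl
  ∑<-0 (suc n) = ≈-trans (+-congʳ (∑<-0 n)) (+-identityʳ 0#)

  ∑<-+ : ∀ n (f g : ℕ → Carrier) → ∑[ i < n ] (f i + g i) ≈ ∑< n f + ∑< n g
  ∑<-+ zero    f g = ≈-sym (+-identityˡ 0#)
  ∑<-+ (suc n) f g = ≈-trans (+-congʳ (∑<-+ n f g))
    (solve 4 (λ a b c d → (a :+ b) :+ (c :+ d) := (a :+ c) :+ (b :+ d)) ≈-refl (∑< n f) (∑< n g) (f n) (g n))

  ∑<-*ˡ : ∀ n (k : Carrier) (f : ℕ → Carrier) → ∑[ i < n ] (k * f i) ≈ k * ∑< n f
  ∑<-*ˡ zero    k f = ≈-sym (zeroʳ k)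
  ∑<-*ˡ (suc n) k f = ≈-trans (+-congʳ (∑<-*ˡ n k f)) (≈-sym (distribˡ k (∑< n f) (f n)))

  ∑<-*ʳ : ∀ n (k : Carrier) (f : ℕ → Carrier) → ∑[ i < n ] (f i * k) ≈ ∑< n f * k
  ∑<-*ʳ zero    k f = ≈-sym (zeroˡ k)
  ∑<-*ʳ (suc n) k f = ≈-trans (+-congʳ (∑<-*ʳ n k f)) (≈-sym (distribʳ k (∑< n f) (f n)))

  ∑<-suc : ∀ n (f : ℕ → Carrier) → ∑< (suc n) f ≈ f 0 + ∑[ i < n ] f (suc i)
  ∑<-suc zero    f = ≈-trans (+-identityˡ (f 0)) (≈-sym (+-identityʳ (f 0)))
  ∑<-suc (suc n) f = ≈-trans (+-congʳ (∑<-suc n f)) (+-assoc _ _ _)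

  ∑-∑< : {A : Set} (xs : List A) (n : ℕ) (h : A → ℕ → Carrier) →
    ∑[ x ∈ xs ] ∑[ i < n ] h x i ≈ ∑[ i < n ] ∑[ x ∈ xs ] h x i
  ∑-∑< xs zero    h = ∑-0 xs
  ∑-∑< xs (suc n) h = ≈-trans (∑-+ xs (λ x → ∑< n (h x)) (λ x → h x n)) (+-congʳ (∑-∑< xs n h))

  ∑-applyUpTo : ∀ n (g : ℕ → ℕ) (f : ℕ → Carrier) → ∑ (applyUpTo g n) f ≈ ∑[ i < n ] f (g i)
  ∑-applyUpTo zero    g f = ≈-refl
  ∑-applyUpTo (suc n) g f =
    ≈-trans (+-congˡ (∑-applyUpTo n (g ∘ suc) f)) (≈-sym (∑<-suc n (f ∘ g)))

  δ-≢ : ∀ {r k} (G : ℕ → Carrier) → r ≢ k → (if does (r ℕ.≟ k) then G k else 0#) ≈ 0#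
  δ-≢ {r} {k} G r≢k with r ℕ.≡ᵇ k in r≡ᵇk
  ... | true  = ⊥-elim (r≢k (ℕP.≡ᵇ⇒≡ r k (subst T (sym r≡ᵇk) _)))
  ... | false = ≈-refl

  δ-≡ : ∀ r (G : ℕ → Carrier) → (if does (r ℕ.≟ r) then G r else 0#) ≈ G r
  δ-≡ r G with r ℕ.≡ᵇ r in r≡ᵇr
  ... | true  = ≈-refl
  ... | false = ⊥-elim (subst T r≡ᵇr (ℕP.≡⇒≡ᵇ r r refl))

  ∑<-δ : ∀ n {r} (G : ℕ → Carrier) → r ≤ n → ∑[ k < suc n ] (if does (r ℕ.≟ k) then G k else 0#) ≈ G r
  ∑<-δ n {r} G r≤n with ℕP.m≤n⇒m<n∨m≡n r≤n
  ... | inj₂ refl = ≈-trans (+-cong (≈-trans (∑<-cong r (λ k k<r → δ-≢ G (ℕP.>⇒≢ k<r))) (∑<-0 r)) (δ-≡ r G))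
                            (+-identityˡ (G r))
  ∑<-δ (suc n) G _ | inj₁ (s≤s r≤n) =
    ≈-trans (+-cong (∑<-δ n G r≤n) (δ-≢ G (ℕP.<⇒≢ (s≤s r≤n)))) (+-identityʳ _)

  ∑-fibres : {A : Set} (f : A → ℕ) (n : ℕ) (xs : List A) → All (λ x → f x ≤ n) xs → (F : ℕ → A → Carrier) →
    ∑[ k ∈ upTo (suc n) ] ∑ (filter (λ x → f x ℕ.≟ k) xs) (F k) ≈ ∑[ x ∈ xs ] F (f x) x
  ∑-fibres f n xs fxs≤n F = begin
    ∑[ k ∈ upTo (suc n) ] ∑ (filter (λ x → f x ℕ.≟ k) xs) (F k)
      ≈⟨ ∑-cong (upTo (suc n)) (λ k → ∑-filter (λ x → f x ℕ.≟ k) xs (F k)) ⟩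
    ∑[ k ∈ upTo (suc n) ] ∑[ x ∈ xs ] δ k x
      ≈⟨ ∑-comm (upTo (suc n)) xs δ ⟩
    ∑[ x ∈ xs ] ∑[ k ∈ upTo (suc n) ] δ k x
      ≈⟨ ∑-cong-All (All.map (λ {x} fx≤n → ≈-trans (∑-applyUpTo (suc n) id (λ k → δ k x)) (∑<-δ n (λ k → F k x) fx≤n)) fxs≤n) ⟩
    ∑[ x ∈ xs ] F (f x) x ∎
    where
    δ : ℕ → _ → Carrier
    δ k x = if does (f x ℕ.≟ k) then F k x else 0#

  ∑≤< : ℕ → ℕ → (ℕ → Carrier) → Carrier
  ∑≤< k N f = ∑[ j < N ] (if j <ᵇ k then 0# else f j)
  syntax ∑≤< k N (λ j → e) = ∑[ k ≤ j < N ] e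

  ∑≤<-suc : ∀ {k N} (f : ℕ → Carrier) → k ≤ N → ∑≤< k (suc N) f ≈ ∑≤< k N f + f N
  ∑≤<-suc {k} {N} f k≤N = +-congˡ (reflexive (cong (λ t → if t then 0# else f N) (≥⇒<ᵇ≡false k≤N)))

  ∑≤<-empty : ∀ N (f : ℕ → Carrier) → ∑≤< N N f ≈ 0#
  ∑≤<-empty N f = ≈-trans (∑<-cong N (λ j j<N → reflexive (cong (λ t → if t then 0# else f j) (<⇒<ᵇ≡true j<N)))) (∑<-0 N)

  telescope : ∀ N (f v : ℕ → Carrier) → (∀ j → j < N → f j ≈ f (suc j) + v j) →
    ∀ {k} → k ≤ N → f k ≈ f N + ∑[ k ≤ j < N ] v j
  telescope N f v step {k} k≤N with ℕP.m≤n⇒m<n∨m≡n k≤N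
  ... | inj₂ refl = ≈-sym (≈-trans (+-congˡ (∑≤<-empty k v)) (+-identityʳ (f k)))
  telescope (suc N) f v step {k} _ | inj₁ (s≤s k≤N) = begin
    f k                             ≈⟨ telescope N f v (λ j j<N → step j (ℕP.m≤n⇒m≤1+n j<N)) k≤N ⟩
    f N + ∑≤< k N v                 ≈⟨ +-congʳ (step N ℕP.≤-refl) ⟩
    (f (suc N) + v N) + ∑≤< k N v   ≈⟨ solve 3 (λ a b c → (a :+ b) :+ c := a :+ (c :+ b)) ≈-refl (f (suc N)) (v N) (∑≤< k N v) ⟩
    f (suc N) + (∑≤< k N v + v N)   ≈⟨ +-congˡ (∑≤<-suc v k≤N) ⟨
    f (suc N) + ∑≤< k (suc N) v     ∎

  ∑≤<-interchange : ∀ N (v t : ℕ → Carrier) →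
    ∑[ k < N ] ((∑[ k ≤ j < N ] v j) * t k) ≈ ∑[ j < N ] (v j * ∑[ i < suc j ] t i)
  ∑≤<-interchange zero    v t = ≈-refl
  ∑≤<-interchange (suc N) v t = begin
    ∑[ k < N ] (∑≤< k (suc N) v * t k) + ∑≤< N (suc N) v * t N
      ≈⟨ +-cong (∑<-cong N (λ k k<N → *-congʳ (∑≤<-suc v (ℕP.<⇒≤ k<N))))
                (*-congʳ (≈-trans (∑≤<-suc v ℕP.≤-refl) (≈-trans (+-congʳ (∑≤<-empty N v)) (+-identityˡ (v N))))) ⟩
    ∑[ k < N ] ((∑≤< k N v + v N) * t k) + v N * t N
      ≈⟨ +-congʳ (≈-trans (∑<-cong N (λ k _ → distribʳ (t k) _ _)) (∑<-+ N _ _)) ⟩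
    (∑[ k < N ] (∑≤< k N v * t k) + ∑[ k < N ] (v N * t k)) + v N * t N
      ≈⟨ +-congʳ (+-cong (∑≤<-interchange N v t) (∑<-*ˡ N (v N) t)) ⟩
    (∑[ j < N ] (v j * ∑< (suc j) t) + v N * ∑< N t) + v N * t N
      ≈⟨ ≈-trans (+-assoc _ _ _) (+-congˡ (≈-sym (distribˡ (v N) (∑< N t) (t N)))) ⟩
    ∑[ j < N ] (v j * ∑< (suc j) t) + v N * ∑< (suc N) t ∎

  -- Complete homogeneous symmetric polynomials

  H : ℕ → List Carrier → Carrier
  H zero    ws       = 1#
  H (suc k) []       = 0#
  H (suc k) (w ∷ ws) = H (suc k) ws + w * H k (w ∷ ws)

  H-1∷ : ∀ k ws → H k (1# ∷ ws) ≈ ∑[ j < suc k ] H j ws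
  H-1∷ zero    ws = ≈-sym (+-identityˡ 1#)
  H-1∷ (suc k) ws = begin
    H (suc k) ws + 1# * H k (1# ∷ ws)           ≈⟨ +-congˡ (≈-trans (*-identityˡ _) (H-1∷ k ws)) ⟩
    H (suc k) ws + ∑[ j < suc k ] H j ws        ≈⟨ +-comm _ _ ⟩
    ∑[ j < suc k ] H j ws + H (suc k) ws        ∎

  H-scale : ∀ (c : Carrier) k ws → H k (map (c *_) ws) ≈ c ^ k * H k ws
  H-scale c zero    ws       = ≈-sym (*-identityʳ 1#)
  H-scale c (suc k) []       = ≈-sym (zeroʳ _)
  H-scale c (suc k) (w ∷ ws) = begin
    H (suc k) (map (c *_) ws) + c * w * H k (c * w ∷ map (c *_) ws)
      ≈⟨ +-cong (H-scale c (suc k) ws) (*-congˡ (H-scale c k (w ∷ ws))) ⟩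
    c ^ suc k * H (suc k) ws + c * w * (c ^ k * H k (w ∷ ws))
      ≈⟨ solve 5 (λ c cᵏ a w b → c :* cᵏ :* a :+ c :* w :* (cᵏ :* b) := c :* cᵏ :* (a :+ w :* b)) ≈-refl
                 c (c ^ k) (H (suc k) ws) w (H k (w ∷ ws)) ⟩
    c ^ suc k * (H (suc k) ws + w * H k (w ∷ ws)) ∎

  H-exchange-head : ∀ {u v d} → u ≈ v + d → ∀ k B → H (suc k) (u ∷ B) ≈ H (suc k) (v ∷ B) + d * H k (v ∷ u ∷ B)
  H-exchange-head {u} {v} {d} u≈v+d zero B = begin
    H 1 B + u * 1#              ≈⟨ +-congˡ (*-congʳ u≈v+d) ⟩
    H 1 B + (v + d) * 1#        ≈⟨ solve 4 (λ h v d o → h :+ (v :+ d) :* o := (h :+ v :* o) :+ d :* o) ≈-refl (H 1 B) v d 1# ⟩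
    (H 1 B + v * 1#) + d * 1#   ∎
  H-exchange-head {u} {v} {d} u≈v+d (suc k) B = begin
    H (suc (suc k)) B + u * H (suc k) (u ∷ B)
      ≈⟨ +-congˡ (*-cong u≈v+d (H-exchange-head u≈v+d k B)) ⟩
    H (suc (suc k)) B + (v + d) * (Hᵥ + d * Hᵤᵥ)
      ≈⟨ solve 5 (λ h v d hᵥ hᵤᵥ → h :+ (v :+ d) :* (hᵥ :+ d :* hᵤᵥ) := (h :+ v :* hᵥ) :+ d :* ((hᵥ :+ d :* hᵤᵥ) :+ v :* hᵤᵥ))
                 ≈-refl (H (suc (suc k)) B) v d Hᵥ Hᵤᵥ ⟩
    (H (suc (suc k)) B + v * Hᵥ) + d * ((Hᵥ + d * Hᵤᵥ) + v * Hᵤᵥ)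
      ≈⟨ +-congˡ (*-congˡ (+-congʳ (H-exchange-head u≈v+d k B))) ⟨
    (H (suc (suc k)) B + v * Hᵥ) + d * (H (suc k) (u ∷ B) + v * Hᵤᵥ) ∎
    where
    Hᵥ  = H (suc k) (v ∷ B)
    Hᵤᵥ = H k (v ∷ u ∷ B)

  H-exchange : ∀ {u v d} → u ≈ v + d → ∀ A B k →
    H (suc k) (A ++ u ∷ B) ≈ H (suc k) (A ++ v ∷ B) + d * H k (A ++ v ∷ u ∷ B)
  H-exchange u≈v+d []      B k = H-exchange-head u≈v+d k B
  H-exchange {u} {v} {d} u≈v+d (a ∷ A) B zero = begin
    H 1 (A ++ u ∷ B) + a * 1#                ≈⟨ +-congʳ (H-exchange u≈v+d A B zero) ⟩
    (H 1 (A ++ v ∷ B) + d * 1#) + a * 1#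
      ≈⟨ solve 4 (λ h d a o → (h :+ d :* o) :+ a :* o := (h :+ a :* o) :+ d :* o) ≈-refl (H 1 (A ++ v ∷ B)) d a 1# ⟩
    (H 1 (A ++ v ∷ B) + a * 1#) + d * 1#     ∎
  H-exchange {u} {v} {d} u≈v+d (a ∷ A) B (suc k) = begin
    H (suc (suc k)) (A ++ u ∷ B) + a * H (suc k) (a ∷ A ++ u ∷ B)
      ≈⟨ +-cong (H-exchange u≈v+d A B (suc k)) (*-congˡ (H-exchange u≈v+d (a ∷ A) B k)) ⟩
    (H (suc (suc k)) (A ++ v ∷ B) + d * H₁) + a * (H₂ + d * H₃)
      ≈⟨ solve 6 (λ h d h₁ a h₂ h₃ → (h :+ d :* h₁) :+ a :* (h₂ :+ d :* h₃) := (h :+ a :* h₂) :+ d :* (h₁ :+ a :* h₃))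
                 ≈-refl (H (suc (suc k)) (A ++ v ∷ B)) d H₁ a H₂ H₃ ⟩
    (H (suc (suc k)) (A ++ v ∷ B) + a * H₂) + d * (H₁ + a * H₃) ∎
    where
    H₁ = H (suc k) (A ++ v ∷ u ∷ B)
    H₂ = H (suc k) (a ∷ A ++ v ∷ B)
    H₃ = H k (a ∷ A ++ v ∷ u ∷ B)

  x≈y+[x-y] : ∀ x y → x ≈ y + (x - y)
  x≈y+[x-y] x y = begin
    x                 ≈⟨ +-identityʳ x ⟨
    x + 0#            ≈⟨ +-congˡ (-‿inverseʳ y) ⟨
    x + (y - y)       ≈⟨ solve 3 (λ x y y⁻ → x :+ (y :+ y⁻) := y :+ (x :+ y⁻)) ≈-refl x y (- y) ⟩
    y + (x - y)       ∎

  x≈y+z⇒z≈x-y : ∀ {x y z} → x ≈ y + z → z ≈ x - y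
  x≈y+z⇒z≈x-y {x} {y} {z} x≈y+z = begin
    z                 ≈⟨ x≈y+[x-y] z (- y) ⟩
    - y + (z - - y)   ≈⟨ solve 3 (λ y⁻ z y⁻⁻ → y⁻ :+ (z :+ y⁻⁻) := (y⁻⁻ :+ z) :+ y⁻) ≈-refl (- y) z (- - y) ⟩
    (- - y + z) - y   ≈⟨ +-congʳ (+-congʳ (-‿involutive y)) ⟩
    (y + z) - y       ≈⟨ +-congʳ x≈y+z ⟨
    x - y             ∎

  [1-p]*x≈x-p*x : ∀ p x → (1# - p) * x ≈ x - p * x
  [1-p]*x≈x-p*x p x = begin
    (1# - p) * x      ≈⟨ distribʳ x 1# (- p) ⟩
    1# * x + - p * x  ≈⟨ +-cong (*-identityˡ x) (≈-sym (-‿distribˡ-* p x)) ⟩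
    x - p * x         ∎

  x≈p*x+[1-p]*x : ∀ p x → x ≈ p * x + (1# - p) * x
  x≈p*x+[1-p]*x p x = ≈-trans (x≈y+[x-y] x (p * x)) (+-congˡ (≈-sym ([1-p]*x≈x-p*x p x)))

  downFrom₁-telescope : ∀ n (f t : ℕ → Carrier) → (∀ a → a < n → f (suc a) ≈ f a + t (suc a)) →
    f n ≈ f 0 + ∑ (downFrom₁ n) t
  downFrom₁-telescope zero    f t step = ≈-sym (+-identityʳ (f 0))
  downFrom₁-telescope (suc n) f t step = begin
    f (suc n)                          ≈⟨ step n ℕP.≤-refl ⟩
    f n + t (suc n)                    ≈⟨ +-congʳ (downFrom₁-telescope n f t (λ a a<n → step a (ℕP.m≤n⇒m≤1+n a<n))) ⟩
    (f 0 + ∑ (downFrom₁ n) t) + t (suc n) ≈⟨ solve 3 (λ a b c → (a :+ b) :+ c := a :+ (c :+ b)) ≈-refl (f 0) _ _ ⟩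
    f 0 + (t (suc n) + ∑ (downFrom₁ n) t) ∎

  module _ (q : Carrier) (g : ℕ → Carrier) where

    scaledAbove : ℕ → ℕ → Carrier
    scaledAbove a b = if a <ᵇ b then q * g b else g b

    -- On downFrom₁ (suc n) this lists q g n, …, q g a, g a, …, g 1.
    doubledAt : ℕ → ℕ → Carrier
    doubledAt a b = if a <ᵇ b then q * g (pred b) else g b

    private
      qg : ℕ → Carrier
      qg b = q * g b

    module _ (k : ℕ) where

      private
        P : ℕ → ℕ → Carrier
        P n a = H (suc k) (map (scaledAbove a) (downFrom₁ n))

        t : ℕ → ℕ → Carrier
        t n a = (1# - q) * g a * H k (map (doubledAt a) (downFrom₁ (suc n)))

      scaledAbove-step : ∀ j a → P (j ℕ.+ suc a) (suc a) ≈ P (j ℕ.+ suc a) a + t (j ℕ.+ suc a) (suc a)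
      scaledAbove-step j a = begin
        H (suc k) (map (scaledAbove (suc a)) (downFrom₁ (j ℕ.+ suc a)))
          ≡⟨ cong (H (suc k)) (map-threshold qg g j (suc a)) ⟩
        H (suc k) (A ++ g (suc a) ∷ B)
          ≈⟨ H-exchange (x≈p*x+[1-p]*x q (g (suc a))) A B k ⟩
        H (suc k) (A ++ qg (suc a) ∷ B) + (1# - q) * g (suc a) * H k (A ++ qg (suc a) ∷ g (suc a) ∷ B)
          ≡⟨ cong₂ (λ l m → H (suc k) l + (1# - q) * g (suc a) * H k m)
                   (sym (map-threshold-pred qg g j a)) (sym (map-threshold-double qg g j a)) ⟩
        P (j ℕ.+ suc a) a + t (j ℕ.+ suc a) (suc a) ∎
        where
        A = map qg (above j (suc a))
        B = map g (downFrom₁ a)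

      ∑-H-doubledAt : ∀ n →
        ∑[ a ∈ downFrom₁ n ] ((1# - q) * g a * H k (map (doubledAt a) (downFrom₁ (suc n))))
          ≈ (1# - q ^ suc k) * H (suc k) (map g (downFrom₁ n))
      ∑-H-doubledAt n = begin
        ∑ (downFrom₁ n) (t n)         ≈⟨ x≈y+z⇒z≈x-y (downFrom₁-telescope n (P n) (t n) step) ⟩
        P n n - P n 0                 ≈⟨ +-cong (reflexive top) (-‿cong bottom) ⟩
        Hg - q ^ suc k * Hg           ≈⟨ [1-p]*x≈x-p*x (q ^ suc k) Hg ⟨
        (1# - q ^ suc k) * Hg         ∎
        where
        Hg = H (suc k) (map g (downFrom₁ n))
        step : ∀ a → a < n → P n (suc a) ≈ P n a + t n (suc a)
        step a a<n = subst (λ m → P m (suc a) ≈ P m a + t m (suc a)) (ℕP.m∸n+n≡m a<n) (scaledAbove-step (n ∸ suc a) a)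
        top : P n n ≡ Hg
        top = cong (H (suc k)) (map-cong-local
          (All.map (λ {b} b≤n → cong (λ c → if c then qg b else g b) (≥⇒<ᵇ≡false b≤n)) (downFrom₁-≤ n)))
        bottom : P n 0 ≈ q ^ suc k * Hg
        bottom = begin
          P n 0
            ≡⟨ cong (H (suc k)) (trans (map-cong-local
                 (All.map (λ {b} 1≤b → cong (λ c → if c then qg b else g b) (<⇒<ᵇ≡true 1≤b)) (downFrom₁-≥1 n)))
                 (map-∘ (downFrom₁ n))) ⟩
          H (suc k) (map (q *_) (map g (downFrom₁ n))) ≈⟨ H-scale q (suc k) (map g (downFrom₁ n)) ⟩
          q ^ suc k * Hg                 ∎

  ^-+ : ∀ a m n → a ^ (m ℕ.+ n) ≈ a ^ m * a ^ n
  ^-+ a zero    n = ≈-sym (*-identityˡ _)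
  ^-+ a (suc m) n = ≈-trans (*-congˡ (^-+ a m n)) (≈-sym (*-assoc _ _ _))

  ∑-insertions-bump : ∀ n τ (f : List ℕ → Carrier) →
    ∑[ a ∈ downFrom₁ (suc n) ] ∑[ u ∈ insertions (suc (suc n)) (map (bump a) τ) ] f (a ∷ u)
      ≈ ∑[ ρ ∈ insertions (suc n) τ ] ∑[ a ∈ downFrom₁ (suc n) ] f (a ∷ map (bump a) ρ)
  ∑-insertions-bump n τ f = begin
    ∑[ a ∈ downFrom₁ (suc n) ] ∑[ u ∈ insertions (suc (suc n)) (map (bump a) τ) ] f (a ∷ u)
      ≈⟨ ∑-cong-All (All.map (λ {a} a≤n → reflexive (cong (λ m → ∑[ u ∈ insertions m (map (bump a) τ) ] f (a ∷ u)) (sym (bump-≥ a≤n))))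
                             (downFrom₁-≤ (suc n))) ⟩
    ∑[ a ∈ downFrom₁ (suc n) ] ∑[ u ∈ insertions (bump a (suc n)) (map (bump a) τ) ] f (a ∷ u)
      ≈⟨ ∑-cong (downFrom₁ (suc n)) (λ a → reflexive (cong (λ us → ∑[ u ∈ us ] f (a ∷ u)) (sym (insertions-bump a (suc n) τ)))) ⟩
    ∑[ a ∈ downFrom₁ (suc n) ] ∑[ u ∈ map (map (bump a)) (insertions (suc n) τ) ] f (a ∷ u)
      ≈⟨ ∑-cong (downFrom₁ (suc n)) (λ a → ∑-map (map (bump a)) (insertions (suc n) τ) (λ u → f (a ∷ u))) ⟩
    ∑[ a ∈ downFrom₁ (suc n) ] ∑[ ρ ∈ insertions (suc n) τ ] f (a ∷ map (bump a) ρ)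
      ≈⟨ ∑-comm (downFrom₁ (suc n)) (insertions (suc n) τ) (λ a ρ → f (a ∷ map (bump a) ρ)) ⟩
    ∑[ ρ ∈ insertions (suc n) τ ] ∑[ a ∈ downFrom₁ (suc n) ] f (a ∷ map (bump a) ρ) ∎

  map-bump-id : ∀ {a τ} → All (_< a) τ → map (bump a) τ ≡ τ
  map-bump-id []           = refl
  map-bump-id (x<a ∷ τ<a) = cong₂ _∷_ (bump-< x<a) (map-bump-id τ<a)

  ∑-perms-suc : ∀ n (f : List ℕ → Carrier) →
    ∑ (perms (suc n)) f ≈ ∑[ τ ∈ perms n ] ∑[ a ∈ downFrom₁ (suc n) ] f (a ∷ map (bump a) τ)
  ∑-perms-suc zero    f = +-congʳ (≈-sym (+-identityʳ _))
  ∑-perms-suc (suc n) f = begin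
    ∑ (perms (suc (suc n))) f
      ≈⟨ ∑-concatMap (insertions (suc (suc n))) (perms (suc n)) f ⟩
    ∑[ ρ ∈ perms (suc n) ] ∑ (insertions (suc (suc n)) ρ) f
      ≈⟨ ∑-perms-suc n (λ ρ → ∑ (insertions (suc (suc n)) ρ) f) ⟩
    ∑[ τ ∈ perms n ] ∑[ a ∈ downFrom₁ (suc n) ] (f (top ∷ a ∷ map (bump a) τ) + ∑ (map (a ∷_) (insertions top (map (bump a) τ))) f)
      ≈⟨ ∑-cong (perms n) (λ τ → ∑-cong (downFrom₁ (suc n)) (λ a → +-congˡ (∑-map (a ∷_) (insertions top (map (bump a) τ)) f))) ⟩
    ∑[ τ ∈ perms n ] ∑[ a ∈ downFrom₁ (suc n) ] (f (top ∷ a ∷ map (bump a) τ) + ∑[ u ∈ insertions top (map (bump a) τ) ] f (a ∷ u))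
      ≈⟨ ≈-trans (∑-cong (perms n) (λ τ → ∑-+ (downFrom₁ (suc n)) _ _)) (∑-+ (perms n) _ _) ⟩
    ∑[ τ ∈ perms n ] ∑[ a ∈ downFrom₁ (suc n) ] f (top ∷ a ∷ map (bump a) τ)
      + ∑[ τ ∈ perms n ] ∑[ a ∈ downFrom₁ (suc n) ] ∑[ u ∈ insertions top (map (bump a) τ) ] f (a ∷ u)
      ≈⟨ +-cong (≈-sym (∑-perms-suc n (λ ρ → f (top ∷ ρ))))
                (≈-trans (∑-cong (perms n) (λ τ → ∑-insertions-bump n τ f))
                         (≈-sym (∑-concatMap (insertions (suc n)) (perms n) first-entry))) ⟩
    ∑[ ρ ∈ perms (suc n) ] f (top ∷ ρ) + ∑ (perms (suc n)) first-entry
      ≈⟨ +-congʳ (∑-cong-All (All.map (λ ρ<top → reflexive (cong (λ ρ′ → f (top ∷ ρ′)) (sym (map-bump-id ρ<top)))) (perms-< (suc n)))) ⟩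
    ∑[ ρ ∈ perms (suc n) ] f (top ∷ map (bump top) ρ) + ∑ (perms (suc n)) first-entry
      ≈⟨ ∑-+ (perms (suc n)) _ _ ⟨
    ∑[ ρ ∈ perms (suc n) ] ∑[ a ∈ downFrom₁ (suc (suc n)) ] f (a ∷ map (bump a) ρ) ∎
    where
    top = suc (suc n)
    first-entry : List ℕ → Carrier
    first-entry ρ = ∑[ a ∈ downFrom₁ (suc n) ] f (a ∷ map (bump a) ρ)

  module _ (q x : Carrier) where

    permWeight : List ℕ → Carrier
    permWeight []      = 1#
    permWeight (a ∷ σ) = (if all (_<ᵇ a) σ then x else (1# - q) * q ^ specialFrom a σ) * permWeight σ

    permWeight-map : ∀ (g : ℕ → ℕ) → (∀ a b → (g a <ᵇ g b) ≡ (a <ᵇ b)) → ∀ σ → permWeight (map g σ) ≡ permWeight σ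
    permWeight-map g g-<ᵇ []      = refl
    permWeight-map g g-<ᵇ (a ∷ σ) =
      cong₂ _*_ (cong₂ (λ isMax s → if isMax then x else (1# - q) * q ^ s) (all-map a σ) (specialFrom-map a σ))
                (permWeight-map g g-<ᵇ σ)
      where open OrderEmbedding g g-<ᵇ

    permWeight≈ : ∀ σ → permWeight σ ≈ (1# - q) ^ (length σ ∸ rlm σ) * q ^ inv′ σ * x ^ rlm σ
    permWeight≈ [] = ≈-sym (≈-trans (*-identityʳ _) (*-identityˡ 1#))
    permWeight≈ (a ∷ σ) with all (_<ᵇ a) σ in isMax
    ... | true = begin
      x * permWeight σ   ≈⟨ *-congˡ (permWeight≈ σ) ⟩
      x * (P * Q * X)    ≈⟨ solve 4 (λ x P Q X → x :* (P :* Q :* X) := P :* Q :* (x :* X)) ≈-refl x P Q X ⟩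
      P * Q * (x * X)    ≡⟨ cong (λ s → P * q ^ (s ℕ.+ inv′ σ) * (x * X)) (sym (specialFrom-max (all-<ᵇ≡true⇒All σ isMax))) ⟩
      P * q ^ (specialFrom a σ ℕ.+ inv′ σ) * (x * X) ∎
      where
      P = (1# - q) ^ (length σ ∸ rlm σ)
      Q = q ^ inv′ σ
      X = x ^ rlm σ
    ... | false = begin
      (1# - q) * q ^ s * permWeight σ   ≈⟨ *-congˡ (permWeight≈ σ) ⟩
      (1# - q) * q ^ s * (P * Q * X)
        ≈⟨ solve 5 (λ p Qₛ P Q X → p :* Qₛ :* (P :* Q :* X) := p :* P :* (Qₛ :* Q) :* X) ≈-refl (1# - q) (q ^ s) P Q X ⟩
      (1# - q) * P * (q ^ s * Q) * X
        ≈⟨ *-congʳ (*-cong (reflexive (cong ((1# - q) ^_) (sym (ℕP.+-∸-assoc 1 (rlm≤length σ))))) (≈-sym (^-+ q s (inv′ σ)))) ⟩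
      (1# - q) ^ (suc (length σ) ∸ rlm σ) * q ^ (s ℕ.+ inv′ σ) * X ∎
      where
      s = specialFrom a σ
      P = (1# - q) ^ (length σ ∸ rlm σ)
      Q = q ^ inv′ σ
      X = x ^ rlm σ

    lhs≈∑permWeight : ∀ n → lhs R q x n ≈ ∑ (perms n) permWeight
    lhs≈∑permWeight n = begin
      ∑[ k ∈ upTo (suc n) ] ((1# - q) ^ (n ∸ k) * S₁ R q n k * x ^ k)
        ≈⟨ ∑-cong (upTo (suc n)) (λ k → ≈-trans (*-congʳ (≈-sym (∑-*ˡ (ofRlm k) _ _))) (≈-sym (∑-*ʳ (ofRlm k) _ _))) ⟩
      ∑[ k ∈ upTo (suc n) ] ∑[ σ ∈ ofRlm k ] (F k σ)
        ≈⟨ ∑-fibres rlm n (perms n) (All.map (λ {σ} len≡n → subst (rlm σ ≤_) len≡n (rlm≤length σ)) (perms-length n)) F ⟩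
      ∑[ σ ∈ perms n ] F (rlm σ) σ
        ≈⟨ ∑-cong-All (All.map (λ {σ} len≡n → ≈-sym (≈-trans (permWeight≈ σ) (reflexive (cong (λ m → F′ m σ) len≡n)))) (perms-length n)) ⟩
      ∑ (perms n) permWeight ∎
      where
      ofRlm : ℕ → List (List ℕ)
      ofRlm k = filter (λ σ → rlm σ ℕ.≟ k) (perms n)
      F′ : ℕ → List ℕ → Carrier
      F′ m σ = (1# - q) ^ (m ∸ rlm σ) * q ^ inv′ σ * x ^ rlm σ
      F : ℕ → List ℕ → Carrier
      F k σ = (1# - q) ^ (n ∸ k) * q ^ inv′ σ * x ^ k

    gapWeight : List ℕ → ℕ → Carrier
    gapWeight σ b = q ^ specialAtFront σ b

    gaps : ℕ → List ℕ → List Carrier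
    gaps n σ = map (gapWeight σ) (downFrom₁ n)

    permGF : ℕ → ℕ → Carrier
    permGF k n = ∑[ σ ∈ perms n ] (permWeight σ * H k (gaps n σ))

    module _ {n} (τ : List ℕ) (τ<n : All (_< suc n) τ) (n∈τ : 1 ≤ n → Any (_≡ n) τ) where

      gapWeight-∷ : ∀ {a b} → 1 ≤ a → b ≤ suc n → gapWeight (a ∷ map (bump a) τ) b ≡ doubledAt q (gapWeight τ) a b
      gapWeight-∷ {a} {b} 1≤a b≤1+n with ℕP.≤-<-connex b a
      ... | inj₁ b≤a = trans (cong (q ^_) (specialAtFront-∷-≤ τ b≤a))
                             (cong (λ c → if c then q * gapWeight τ (pred b) else gapWeight τ b) (sym (≥⇒<ᵇ≡false b≤a)))
      ... | inj₂ (s≤s {n = b′} a≤b′) =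
        trans (cong (q ^_) (specialAtFront-∷-> τ a≤b′ b′≤n (n∈τ (ℕP.≤-trans 1≤a (ℕP.≤-trans a≤b′ b′≤n)))))
              (cong (λ c → if c then q * gapWeight τ b′ else gapWeight τ (suc b′)) (sym (<⇒<ᵇ≡true (s≤s a≤b′))))
        where b′≤n = ℕP.≤-pred b≤1+n

      gaps-∷ : ∀ {a} → 1 ≤ a → gaps (suc n) (a ∷ map (bump a) τ) ≡ map (doubledAt q (gapWeight τ) a) (downFrom₁ (suc n))
      gaps-∷ 1≤a = map-cong-local (All.zipWith (λ (1≤b , b≤1+n) → gapWeight-∷ 1≤a b≤1+n)
                                               (downFrom₁-≥1 (suc n) , downFrom₁-≤ (suc n)))

      permWeight-∷-max : permWeight (suc n ∷ map (bump (suc n)) τ) ≡ x * permWeight τ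
      permWeight-∷-max rewrite map-bump-id τ<n | all-<ᵇ≡true τ<n = refl

      permWeight-∷ : ∀ {a} → 1 ≤ a → a ≤ n → permWeight (a ∷ map (bump a) τ) ≡ (1# - q) * gapWeight τ a * permWeight τ
      permWeight-∷ {a} 1≤a a≤n = cong₂ (λ isMax w → (if isMax then x else (1# - q) * gapWeight τ a) * w)
        (all-<ᵇ≡false (Anyₚ.map⁺ (Any.map (λ { refl → subst (a ≤_) (sym (bump-≥ a≤n)) (ℕP.m≤n⇒m≤1+n a≤n) })
                                          (n∈τ (ℕP.≤-trans 1≤a a≤n)))))
        (permWeight-map (bump a) (bump-<ᵇ a) τ)

      gaps-∷-max : gaps (suc n) (suc n ∷ map (bump (suc n)) τ) ≡ 1# ∷ gaps n τ
      gaps-∷-max = trans (map-cong-local (All.map (λ b≤1+n → cong (q ^_) (specialAtFront-∷-≤ τ b≤1+n)) (downFrom₁-≤ (suc n))))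
                         (cong (λ s → q ^ s ∷ gaps n τ) (trans (cong (specialFrom (suc n)) (map-bump-id τ<n)) (specialFrom-max τ<n)))

      ∑-first-entry : ∀ k →
        ∑[ a ∈ downFrom₁ (suc n) ] (permWeight (a ∷ map (bump a) τ) * H k (gaps (suc n) (a ∷ map (bump a) τ)))
          ≈ x * (permWeight τ * ∑[ j < suc k ] H j (gaps n τ)) + (1# - q ^ suc k) * (permWeight τ * H (suc k) (gaps n τ))
      ∑-first-entry k = begin
        term (suc n) + ∑ (downFrom₁ n) term
          ≈⟨ +-cong top (∑-cong-All (All.zipWith (λ (1≤a , a≤n) → below 1≤a a≤n) (downFrom₁-≥1 n , downFrom₁-≤ n))) ⟩
        x * (W * ∑[ j < suc k ] H j (gaps n τ)) + ∑[ a ∈ downFrom₁ n ] (W * ((1# - q) * gapWeight τ a * H k (Y a)))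
          ≈⟨ +-congˡ (≈-trans (∑-*ˡ (downFrom₁ n) W _) (*-congˡ (∑-H-doubledAt q (gapWeight τ) k n))) ⟩
        x * (W * ∑[ j < suc k ] H j (gaps n τ)) + W * ((1# - q ^ suc k) * H (suc k) (gaps n τ))
          ≈⟨ +-congˡ (solve 3 (λ w c h → w :* (c :* h) := c :* (w :* h)) ≈-refl W (1# - q ^ suc k) (H (suc k) (gaps n τ))) ⟩
        x * (W * ∑[ j < suc k ] H j (gaps n τ)) + (1# - q ^ suc k) * (W * H (suc k) (gaps n τ)) ∎
        where
        W = permWeight τ
        Y : ℕ → List Carrier
        Y a = map (doubledAt q (gapWeight τ) a) (downFrom₁ (suc n))
        term : ℕ → Carrier
        term a = permWeight (a ∷ map (bump a) τ) * H k (gaps (suc n) (a ∷ map (bump a) τ))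
        top : term (suc n) ≈ x * (W * ∑[ j < suc k ] H j (gaps n τ))
        top = begin
          term (suc n)                          ≡⟨ cong₂ (λ w l → w * H k l) permWeight-∷-max gaps-∷-max ⟩
          x * W * H k (1# ∷ gaps n τ)           ≈⟨ *-assoc x W _ ⟩
          x * (W * H k (1# ∷ gaps n τ))         ≈⟨ *-congˡ (*-congˡ (H-1∷ k (gaps n τ))) ⟩
          x * (W * ∑[ j < suc k ] H j (gaps n τ)) ∎
        below : ∀ {a} → 1 ≤ a → a ≤ n → term a ≈ W * ((1# - q) * gapWeight τ a * H k (Y a))
        below {a} 1≤a a≤n = begin
          term a                                          ≡⟨ cong₂ (λ w l → w * H k l) (permWeight-∷ 1≤a a≤n) (gaps-∷ 1≤a) ⟩
          (1# - q) * gapWeight τ a * W * H k (Y a)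
            ≈⟨ solve 4 (λ c g w h → c :* g :* w :* h := w :* (c :* g :* h)) ≈-refl (1# - q) (gapWeight τ a) W (H k (Y a)) ⟩
          W * ((1# - q) * gapWeight τ a * H k (Y a))      ∎

    permGF-suc : ∀ k n → permGF k (suc n) ≈ x * ∑[ j < suc k ] permGF j n + (1# - q ^ suc k) * permGF (suc k) n
    permGF-suc k n = begin
      permGF k (suc n)
        ≈⟨ ∑-perms-suc n (λ σ → permWeight σ * H k (gaps (suc n) σ)) ⟩
      ∑[ τ ∈ perms n ] ∑[ a ∈ downFrom₁ (suc n) ] (permWeight (a ∷ map (bump a) τ) * H k (gaps (suc n) (a ∷ map (bump a) τ)))
        ≈⟨ ∑-cong-All (All.zipWith (λ (τ<n , n∈τ) → ∑-first-entry _ τ<n n∈τ k) (perms-< n , perms-∋max n)) ⟩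
      ∑[ τ ∈ perms n ] (x * (permWeight τ * ∑[ j < suc k ] H j (gaps n τ)) + r * (permWeight τ * H (suc k) (gaps n τ)))
        ≈⟨ ≈-trans (∑-+ (perms n) _ _) (+-cong (∑-*ˡ (perms n) x _) (∑-*ˡ (perms n) r _)) ⟩
      x * ∑[ τ ∈ perms n ] (permWeight τ * ∑[ j < suc k ] H j (gaps n τ)) + r * permGF (suc k) n
        ≈⟨ +-congʳ (*-congˡ (∑-cong (perms n) (λ τ → ≈-sym (∑<-*ˡ (suc k) (permWeight τ) (λ j → H j (gaps n τ)))))) ⟩
      x * ∑[ τ ∈ perms n ] ∑[ j < suc k ] (permWeight τ * H j (gaps n τ)) + r * permGF (suc k) n
        ≈⟨ +-congʳ (*-congˡ (∑-∑< (perms n) (suc k) (λ τ j → permWeight τ * H j (gaps n τ)))) ⟩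
      x * ∑[ j < suc k ] permGF j n + r * permGF (suc k) n ∎
      where r = 1# - q ^ suc k

    permGF-0-0 : permGF 0 0 ≈ 1#
    permGF-0-0 = ≈-trans (+-identityʳ _) (*-identityˡ 1#)

    permGF-suc-0 : ∀ k → permGF (suc k) 0 ≈ 0#
    permGF-suc-0 k = ≈-trans (+-identityʳ _) (zeroʳ 1#)

    -- Schröder paths

    pathTerm : ℕ → List Step → Carrier
    pathTerm h w = if isPath h w then weight R q x h w else 0#

    pathGF : ℕ → ℕ → Carrier
    pathGF m h = ∑ (words m) (pathTerm h)

    levelWeight : ℕ → Carrier
    levelWeight h = (x - 1#) + q ^ suc h

    downGF : ℕ → ℕ → Carrier
    downGF m zero    = 0#
    downGF m (suc h) = (1# - q ^ suc h) * pathGF m h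

    levelGF : ℕ → ℕ → Carrier
    levelGF zero    h = 0#
    levelGF (suc m) h = levelWeight h * pathGF m h

    private
      if-* : ∀ b c t → (if b then c * t else 0#) ≈ c * (if b then t else 0#)
      if-* true  c t = ≈-refl
      if-* false c t = ≈-sym (zeroʳ c)

      ∑-prepend : ∀ (s : Step) {h h′} c ws → (∀ w → pathTerm h (s ∷ w) ≈ c * pathTerm h′ w) →
        ∑ (map (s ∷_) ws) (pathTerm h) ≈ c * ∑ ws (pathTerm h′)
      ∑-prepend s c ws step = ≈-trans (∑-map (s ∷_) ws _) (≈-trans (∑-cong ws step) (∑-*ˡ ws c _))

      ∑-U : ∀ h ws → ∑ (map (U ∷_) ws) (pathTerm h) ≈ ∑ ws (pathTerm (suc h))
      ∑-U h ws = ≈-trans (∑-prepend U 1# ws (λ w → if-* (isPath (suc h) w) 1# _)) (*-identityˡ _)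

      ∑-D : ∀ m h → ∑ (map (D ∷_) (words m)) (pathTerm h) ≈ downGF m h
      ∑-D m zero    = ≈-trans (∑-map (D ∷_) (words m) _) (∑-0 (words m))
      ∑-D m (suc h) = ∑-prepend D (1# - q ^ suc h) (words m) (λ w → if-* (isPath h w) _ _)

      ∑-L : ∀ m h → ∑ (map (L₁ ∷_) (words m) ++ map (L₂ ∷_) (words m)) (pathTerm h) ≈ levelWeight h * pathGF m h
      ∑-L m h = begin
        ∑ (map (L₁ ∷_) (words m) ++ map (L₂ ∷_) (words m)) (pathTerm h)
          ≈⟨ ∑-++ (map (L₁ ∷_) (words m)) (map (L₂ ∷_) (words m)) (pathTerm h) ⟩
        ∑ (map (L₁ ∷_) (words m)) (pathTerm h) + ∑ (map (L₂ ∷_) (words m)) (pathTerm h)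
          ≈⟨ +-cong (∑-prepend L₁ (x - 1#) (words m) (λ w → if-* (isPath h w) _ _))
                    (∑-prepend L₂ (q ^ suc h) (words m) (λ w → if-* (isPath h w) _ _)) ⟩
        (x - 1#) * pathGF m h + q ^ suc h * pathGF m h
          ≈⟨ distribʳ (pathGF m h) (x - 1#) (q ^ suc h) ⟨
        levelWeight h * pathGF m h ∎

    pathGF-suc : ∀ m h → pathGF (suc m) h ≈ pathGF m (suc h) + downGF m h + levelGF m h
    pathGF-suc zero h = begin
      ∑ (map (U ∷_) (words 0) ++ map (D ∷_) (words 0)) (pathTerm h)
        ≈⟨ ∑-++ (map (U ∷_) (words 0)) (map (D ∷_) (words 0)) (pathTerm h) ⟩
      ∑ (map (U ∷_) (words 0)) (pathTerm h) + ∑ (map (D ∷_) (words 0)) (pathTerm h)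
        ≈⟨ +-cong (∑-U h (words 0)) (∑-D 0 h) ⟩
      pathGF 0 (suc h) + downGF 0 h
        ≈⟨ +-identityʳ _ ⟨
      pathGF 0 (suc h) + downGF 0 h + 0# ∎
    pathGF-suc (suc m) h = begin
      ∑ (map (U ∷_) (words (suc m)) ++ map (D ∷_) (words (suc m)) ++ Ls) (pathTerm h)
        ≈⟨ ∑-++ (map (U ∷_) (words (suc m))) (map (D ∷_) (words (suc m)) ++ Ls) (pathTerm h) ⟩
      ∑ (map (U ∷_) (words (suc m))) (pathTerm h) + ∑ (map (D ∷_) (words (suc m)) ++ Ls) (pathTerm h)
        ≈⟨ +-cong (∑-U h (words (suc m))) (≈-trans (∑-++ (map (D ∷_) (words (suc m))) Ls (pathTerm h)) (+-cong (∑-D (suc m) h) (∑-L m h))) ⟩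
      pathGF (suc m) (suc h) + (downGF (suc m) h + levelGF (suc m) h)
        ≈⟨ +-assoc _ _ _ ⟨
      pathGF (suc m) (suc h) + downGF (suc m) h + levelGF (suc m) h ∎
      where Ls = map (L₁ ∷_) (words m) ++ map (L₂ ∷_) (words m)

    pathGF-vanish : ∀ m h → m < h → pathGF m h ≈ 0#
    downGF-vanish : ∀ m h → suc m < h → downGF m h ≈ 0#
    levelGF-vanish : ∀ m h → m ≤ h → levelGF m h ≈ 0#

    pathGF-vanish zero    (suc h) _     = +-identityʳ 0#
    pathGF-vanish (suc m) h       1+m<h = begin
      pathGF (suc m) h                              ≈⟨ pathGF-suc m h ⟩
      pathGF m (suc h) + downGF m h + levelGF m h
        ≈⟨ +-cong (+-cong (pathGF-vanish m (suc h) (ℕP.<-trans (ℕP.n<1+n m) (ℕP.m<n⇒m<1+n 1+m<h)))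
                          (downGF-vanish m h 1+m<h))
                  (levelGF-vanish m h (ℕP.<⇒≤ (ℕP.<-trans (ℕP.n<1+n m) 1+m<h))) ⟩
      0# + 0# + 0#                                  ≈⟨ ≈-trans (+-identityʳ _) (+-identityʳ 0#) ⟩
      0#                                            ∎

    downGF-vanish m (suc h) (s≤s 1+m<1+h) = ≈-trans (*-congˡ (pathGF-vanish m h 1+m<1+h)) (zeroʳ _)

    levelGF-vanish zero    h _     = ≈-refl
    levelGF-vanish (suc m) h 1+m≤h = ≈-trans (*-congˡ (pathGF-vanish m h 1+m≤h)) (zeroʳ _)

    suffixGF : ℕ → ℕ → Carrier
    suffixGF a k = pathGF ((a ℕ.+ a) ∸ k) k

    downSuffixGF : ℕ → ℕ → Carrier
    downSuffixGF a zero    = 0#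
    downSuffixGF a (suc k) = (1# - q ^ suc k) * suffixGF a k

    suffixGF-vanish : ∀ {a k} → a < k → suffixGF a k ≈ 0#
    suffixGF-vanish {a} {suc k} a<k = pathGF-vanish _ (suc k) (ℕP.m<n+o⇒m∸n<o (a ℕ.+ a) (suc k) (ℕP.+-mono-< a<k a<k))

    downGF-suffix : ∀ a k → downGF ((a ℕ.+ suc a) ∸ k) k ≈ downSuffixGF a k
    downGF-suffix a zero    = ≈-refl
    downGF-suffix a (suc k) = *-congˡ (reflexive (cong (λ m → pathGF (m ∸ suc k) k) (ℕP.+-suc a a)))

    levelGF-suffix : ∀ a k → k ≤ suc a → levelGF ((a ℕ.+ suc a) ∸ k) k ≈ levelWeight k * suffixGF a k
    levelGF-suffix a k k≤1+a with ℕP.m≤n⇒m<n∨m≡n k≤1+a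
    ... | inj₁ (s≤s k≤a) = reflexive (cong (λ m → levelGF m k)
            (trans (cong (_∸ k) (ℕP.+-suc a a)) (ℕP.+-∸-assoc 1 (ℕP.≤-trans k≤a (ℕP.m≤m+n a a)))))
    ... | inj₂ refl = begin
      levelGF ((a ℕ.+ suc a) ∸ suc a) (suc a)   ≡⟨ cong (λ m → levelGF m (suc a)) (ℕP.m+n∸n≡m a (suc a)) ⟩
      levelGF a (suc a)                         ≈⟨ levelGF-vanish a (suc a) (ℕP.n≤1+n a) ⟩
      0#                                        ≈⟨ zeroʳ _ ⟨
      levelWeight (suc a) * 0#                  ≈⟨ *-congˡ (suffixGF-vanish (ℕP.n<1+n a)) ⟨
      levelWeight (suc a) * suffixGF a (suc a)  ∎

    suffixGF-step : ∀ a k → k ≤ suc a →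
      suffixGF (suc a) k ≈ suffixGF (suc a) (suc k) + (levelWeight k * suffixGF a k + downSuffixGF a k)
    suffixGF-step a k k≤1+a = begin
      suffixGF (suc a) k
        ≡⟨ cong (λ m → pathGF m k) (ℕP.+-∸-assoc 1 (ℕP.≤-trans k≤1+a (ℕP.m≤n+m (suc a) a))) ⟩
      pathGF (suc m) k
        ≈⟨ pathGF-suc m k ⟩
      pathGF m (suc k) + downGF m k + levelGF m k
        ≈⟨ +-cong (+-congˡ (downGF-suffix a k)) (levelGF-suffix a k k≤1+a) ⟩
      suffixGF (suc a) (suc k) + downSuffixGF a k + levelWeight k * suffixGF a k
        ≈⟨ solve 3 (λ s d l → s :+ d :+ l := s :+ (l :+ d)) ≈-refl _ _ _ ⟩
      suffixGF (suc a) (suc k) + (levelWeight k * suffixGF a k + downSuffixGF a k) ∎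
      where m = (a ℕ.+ suc a) ∸ k

    -- Pairing the two families

    pairing : ℕ → ℕ → Carrier
    pairing a b = ∑[ k < suc a ] (suffixGF a k * permGF k b)

    private
      C : ℕ → ℕ → Carrier
      C j b = ∑[ i < suc j ] permGF i b

      V : ℕ → ℕ → Carrier
      V a j = levelWeight j * suffixGF a j + downSuffixGF a j

    levelWeight-absorb : ∀ j (e c t : Carrier) →
      levelWeight j * e * c + (1# - q ^ suc j) * e * (c + t) ≈ e * (x * c + (1# - q ^ suc j) * t)
    levelWeight-absorb j e c t = begin
      ((x - 1#) + p) * e * c + r * e * (c + t)
        ≈⟨ solve 6 (λ m p r e c t → (m :+ p) :* e :* c :+ r :* e :* (c :+ t) := e :* (((p :+ r) :+ m) :* c :+ r :* t)) ≈-refl (x - 1#) p r e c t ⟩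
      e * (((p + r) + (x - 1#)) * c + r * t)
        ≈⟨ *-congˡ (+-congʳ (*-congʳ (≈-trans (+-congʳ (≈-sym (x≈y+[x-y] 1# p))) (≈-sym (x≈y+[x-y] x 1#))))) ⟩
      e * (x * c + r * t) ∎
      where
      p = q ^ suc j
      r = 1# - p

    ∑-V-C : ∀ a b → ∑[ j < suc (suc a) ] (V a j * C j b) ≈ pairing a (suc b)
    ∑-V-C a b = begin
      ∑[ j < N ] (V a j * C j b)
        ≈⟨ ≈-trans (∑<-cong N (λ j _ → distribʳ (C j b) _ _)) (∑<-+ N _ _) ⟩
      ∑[ j < N ] (levelWeight j * suffixGF a j * C j b) + ∑[ j < N ] (downSuffixGF a j * C j b)
        ≈⟨ +-cong level down ⟩
      ∑[ j < suc a ] (levelWeight j * suffixGF a j * C j b) + ∑[ j < suc a ] ((1# - q ^ suc j) * suffixGF a j * C (suc j) b)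
        ≈⟨ ∑<-+ (suc a) _ _ ⟨
      ∑[ j < suc a ] (levelWeight j * suffixGF a j * C j b + (1# - q ^ suc j) * suffixGF a j * (C j b + permGF (suc j) b))
        ≈⟨ ∑<-cong (suc a) (λ j _ → levelWeight-absorb j (suffixGF a j) (C j b) (permGF (suc j) b)) ⟩
      ∑[ j < suc a ] (suffixGF a j * (x * C j b + (1# - q ^ suc j) * permGF (suc j) b))
        ≈⟨ ∑<-cong (suc a) (λ j _ → *-congˡ (≈-sym (permGF-suc j b))) ⟩
      pairing a (suc b) ∎
      where
      N = suc (suc a)
      level : ∑[ j < N ] (levelWeight j * suffixGF a j * C j b) ≈ ∑[ j < suc a ] (levelWeight j * suffixGF a j * C j b)
      level = ≈-trans (+-congˡ (≈-trans (*-congʳ (≈-trans (*-congˡ (suffixGF-vanish (ℕP.n<1+n a))) (zeroʳ _))) (zeroˡ _)))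
                      (+-identityʳ _)
      down : ∑[ j < N ] (downSuffixGF a j * C j b) ≈ ∑[ j < suc a ] ((1# - q ^ suc j) * suffixGF a j * C (suc j) b)
      down = ≈-trans (∑<-suc (suc a) _) (≈-trans (+-congʳ (zeroˡ _)) (+-identityˡ _))

    pairing-suc : ∀ a b → pairing (suc a) b ≈ pairing a (suc b)
    pairing-suc a b = begin
      ∑[ k < N ] (suffixGF (suc a) k * permGF k b)
        ≈⟨ ∑<-cong N (λ k k<N → *-congʳ (suffix-telescope (ℕP.<⇒≤ k<N))) ⟩
      ∑[ k < N ] ((∑[ k ≤ j < N ] V a j) * permGF k b)
        ≈⟨ ∑≤<-interchange N (V a) (λ k → permGF k b) ⟩
      ∑[ j < N ] (V a j * C j b)
        ≈⟨ ∑-V-C a b ⟩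
      pairing a (suc b) ∎
      where
      N = suc (suc a)
      suffix-telescope : ∀ {k} → k ≤ N → suffixGF (suc a) k ≈ ∑[ k ≤ j < N ] V a j
      suffix-telescope k≤N = ≈-trans (telescope N (suffixGF (suc a)) (V a) (λ j j<N → suffixGF-step a j (ℕP.≤-pred j<N)) k≤N)
                                     (≈-trans (+-congʳ (suffixGF-vanish (ℕP.n<1+n (suc a)))) (+-identityˡ _))

    pairing-shift : ∀ a b → pairing a b ≈ pairing 0 (a ℕ.+ b)
    pairing-shift zero    b = ≈-refl
    pairing-shift (suc a) b = ≈-trans (pairing-suc a b) (≈-trans (pairing-shift a (suc b)) (reflexive (cong (pairing 0) (ℕP.+-suc a b))))

    pairing-0 : ∀ b → pairing 0 b ≈ permGF 0 b
    pairing-0 b = ≈-trans (+-identityˡ _) (≈-trans (*-congʳ (+-identityʳ 1#)) (*-identityˡ _))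

    pairing-0ʳ : ∀ a → pairing a 0 ≈ suffixGF a 0
    pairing-0ʳ a = begin
      pairing a 0 ≈⟨ ∑<-suc a (λ k → suffixGF a k * permGF k 0) ⟩
      suffixGF a 0 * permGF 0 0 + ∑[ i < a ] (suffixGF a (suc i) * permGF (suc i) 0)
        ≈⟨ +-cong (*-congˡ permGF-0-0) (≈-trans (∑<-cong a (λ i _ → ≈-trans (*-congˡ (permGF-suc-0 i)) (zeroʳ _))) (∑<-0 a)) ⟩
      suffixGF a 0 * 1# + 0#   ≈⟨ ≈-trans (+-identityʳ _) (*-identityʳ _) ⟩
      suffixGF a 0 ∎

    pathGF≈schroderGF : ∀ n → pathGF (2 ℕ.* n) 0 ≈ schroderGF R q x n
    pathGF≈schroderGF n = ≈-sym (≈-trans (∑-filter (λ w → isPath 0 w Bool.≟ true) (words (2 ℕ.* n)) (weight R q x 0))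
                                         (∑-cong (words (2 ℕ.* n)) (λ w → reflexive (does-≟-true (isPath 0 w)))))
      where
      does-≟-true : ∀ b {t : Carrier} → (if does (b Bool.≟ true) then t else 0#) ≡ (if b then t else 0#)
      does-≟-true true  = refl
      does-≟-true false = refl

    lhs≈schroderGF : ∀ n → lhs R q x n ≈ schroderGF R q x n
    lhs≈schroderGF n = begin
      lhs R q x n               ≈⟨ lhs≈∑permWeight n ⟩
      ∑ (perms n) permWeight    ≈⟨ ∑-cong (perms n) (λ σ → *-identityʳ (permWeight σ)) ⟨
      permGF 0 n                ≈⟨ pairing-0 n ⟨
      pairing 0 n               ≡⟨ cong (pairing 0) (ℕP.+-identityʳ n) ⟨
      pairing 0 (n ℕ.+ 0)       ≈⟨ pairing-shift n 0 ⟨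
      pairing n 0               ≈⟨ pairing-0ʳ n ⟩
      suffixGF n 0              ≡⟨ cong (λ m → pathGF (n ℕ.+ m) 0) (ℕP.+-identityʳ n) ⟨
      pathGF (2 ℕ.* n) 0        ≈⟨ pathGF≈schroderGF n ⟩
      schroderGF R q x n        ∎

lemma5p7 : ∀ {c ℓ} (R : CommutativeRing c ℓ) (q x : CommutativeRing.Carrier R) (n : ℕ)
             → CommutativeRing._≈_ R (lhs R q x n) (schroderGF R q x n)
lemma5p7 R q x n = lhs≈schroderGF R q x n
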